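{- Let $text$ be a string of length $n$ such that $text[1..n-1]$ is squarefree. Let $i,j$ be integers with $0 < i \le j$ and $j - i + 1 \le n - j$. Suppose that for some $k$ with $i \le k \le j$, the suffix $text[k..n]$ is a square, i.e. $text[k..n] = xx$ for some nonempty string $x$. Let $x''$ be the suffix of $x$ of length $n - j - |x|$ (this length lies between $0$ and $|x|$), and write $x = x'x''$; then $text[j+1..n] = x''x'x''$. Under these hypotheses, $x''$ is the longest boundary of $text[j+1..n]$. -}

module Defs where

open import Data.Nat using (ℕ; suc; _∸_; _+_; _≤_; _<_)
open import Data.List using (List; []; _++_; take; drop; length)
open import Data.Product using (Σ; ∃; _×_)
open import Relation.Binary.PropositionalEquality using (_≡_; _≢_)
open import Relation.Nullary using (¬_)

-- Strings over an arbitrary alphabet A are lists; positions are 1-indexed.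

-- text[a..b] (1-indexed, inclusive) = the factor of length b - a + 1 starting at position a
substr : ∀ {a} {A : Set a} → List A → ℕ → ℕ → List A
substr text a b = take (suc b ∸ a) (drop (a ∸ 1) text)

HasSquare : ∀ {a} {A : Set a} → List A → Set a
HasSquare {A = A} w = Σ (List A) λ p → Σ (List A) λ u → Σ (List A) λ s →
  (u ≢ []) × (w ≡ p ++ u ++ u ++ s)

Squarefree : ∀ {a} {A : Set a} → List A → Set a
Squarefree w = ¬ HasSquare w

IsSquareOf : ∀ {a} {A : Set a} → List A → List A → Set a
IsSquareOf w x = (x ≢ []) × (w ≡ x ++ x)

IsBoundary : ∀ {a} {A : Set a} → List A → List A → Set a
IsBoundary {A = A} b w = (length b < length w)
  × (Σ (List A) λ r → w ≡ b ++ r)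
  × (Σ (List A) λ l → w ≡ l ++ b)

IsLongestBoundary : ∀ {a} {A : Set a} → List A → List A → Set a
IsLongestBoundary {A = A} b w =
  IsBoundary b w × (∀ (c : List A) → IsBoundary c w → length c ≤ length b)

-- The square text[k..n] = x x with k ≤ j splits as x = x' x'', where x' is the
-- part of the first copy of x lying in text[k..j]; then
--   text = P x' x'' x' x''   and   text[j+1..n] = x'' x' x''.
-- Clearly x'' is a border of x'' x' x''.  A longer border c = x'' e would make
-- e a nonempty proper border of X = x' x'', i.e. X = q e = e r with r ≠ [];
-- then text = P q e e r contains the square e e before its last letter,
-- contradicting the squarefreeness of text[1..n-1].
module Submission where

open import Defs
open import Level using (Level)
open import Data.Nat using (ℕ; zero; suc; _∸_; _+_; _≤_; _<_; _≤?_; z≤n; s≤s)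
open import Data.Nat.Properties
open import Data.List using (List; []; _∷_; _++_; take; drop; length)
open import Data.List.Properties
  using ( length-++; length-++-sucʳ; ∷-injectiveˡ; ∷-injectiveʳ; ++-conicalˡ; ++-assoc
        ; ++-identityʳ; take-all; length-take; length-drop; take++drop≡id; drop-all )
open import Data.Product using (Σ; _×_; _,_; proj₁; proj₂)
open import Data.Empty using (⊥-elim)
open import Relation.Nullary using (yes; no; contradiction)
open import Relation.Binary.PropositionalEquality

≤-half : ∀ m L → m ≤ (L + L) ∸ m → m ≤ L
≤-half m L h with m ≤? L
... | yes m≤L = m≤L
... | no m≰L = contradiction (m≤o∸n⇒m+n≤o m (≤-trans h (m∸n≤m (L + L) m)) h)
                            (<⇒≱ (+-mono-< L<m L<m))
  where
  L<m : L < m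
  L<m = ≰⇒> m≰L

module _ {a : Level} {A : Set a} where

  -- w without its last letter; the hypothesis of lemma1 is that
  -- substr text 1 (n ∸ 1), which unfolds to dropLast text, is squarefree.
  dropLast : List A → List A
  dropLast w = take (length w ∸ 1) w

  nonempty⇒length>0 : {w : List A} → w ≢ [] → 0 < length w
  nonempty⇒length>0 {[]} w≢[] = ⊥-elim (w≢[] refl)
  nonempty⇒length>0 {_ ∷ _} _ = s≤s z≤n

  take-++-length : (P s : List A) (m : ℕ) → take (length P + m) (P ++ s) ≡ P ++ take m s
  take-++-length [] s m = refl
  take-++-length (y ∷ P) s m = cong (y ∷_) (take-++-length P s m)

  take-length-++ : (P s : List A) → take (length P) (P ++ s) ≡ P
  take-length-++ [] s = refl
  take-length-++ (y ∷ P) s = cong (y ∷_) (take-length-++ P s)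

  drop-length-++ : (P s : List A) → drop (length P) (P ++ s) ≡ s
  drop-length-++ [] s = refl
  drop-length-++ (y ∷ P) s = drop-length-++ P s

  length-++-∸ : (P s : List A) → length (P ++ s) ∸ length P ≡ length s
  length-++-∸ P s = trans (cong (_∸ length P) (length-++ P)) (m+n∸m≡n (length P) (length s))

  ++-split : (as bs cs ds : List A) → as ++ bs ≡ cs ++ ds → length as ≤ length cs →
             Σ (List A) λ q → (cs ≡ as ++ q) × (bs ≡ q ++ ds)
  ++-split [] bs cs ds eq _ = cs , refl , eq
  ++-split (y ∷ as) bs (z ∷ cs) ds eq (s≤s as≤cs)
    with ++-split as bs cs ds (∷-injectiveʳ eq) as≤cs
  ... | q , cs≡ , bs≡ = q , cong₂ _∷_ (sym (∷-injectiveˡ eq)) cs≡ , bs≡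

  dropLast-++ : (Z : List A) (y : A) (r : List A) →
                dropLast (Z ++ y ∷ r) ≡ Z ++ take (length r) (y ∷ r)
  dropLast-++ Z y r =
    trans (cong (λ m → take m (Z ++ y ∷ r)) len) (take-++-length Z (y ∷ r) (length r))
    where
    len : length (Z ++ y ∷ r) ∸ 1 ≡ length Z + length r
    len = trans (cong (_∸ 1) (length-++-sucʳ Z y r)) (length-++ Z)

  hasSquare-++ʳ : (w s : List A) → HasSquare w → HasSquare (w ++ s)
  hasSquare-++ʳ w s (p , u , t , u≢[] , w≡) = p , u , t ++ s , u≢[] , w++s≡
    where
    open ≡-Reasoning
    w++s≡ : w ++ s ≡ p ++ u ++ u ++ t ++ s
    w++s≡ = begin
      w ++ s                     ≡⟨ cong (_++ s) w≡ ⟩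
      (p ++ u ++ u ++ t) ++ s    ≡⟨ ++-assoc p (u ++ u ++ t) s ⟩
      p ++ (u ++ u ++ t) ++ s    ≡⟨ cong (p ++_) (++-assoc u (u ++ t) s) ⟩
      p ++ u ++ (u ++ t) ++ s    ≡⟨ cong (λ v → p ++ u ++ v) (++-assoc u t s) ⟩
      p ++ u ++ u ++ t ++ s      ∎

  long-border⇒border : (u X c : List A) → IsBoundary c (u ++ X) → length u < length c →
                       Σ (List A) λ e → (e ≢ []) × IsBoundary e X
  long-border⇒border u X c (c<w , (r , w≡cr) , (l , w≡lc)) u<c =
    e , e≢[] , e<X , (r , X≡er) , (q , X≡qe)
    where
    split₁ : Σ (List A) λ e → (c ≡ u ++ e) × (X ≡ e ++ r)
    split₁ = ++-split u X c r w≡cr (<⇒≤ u<c)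
    e : List A
    e = proj₁ split₁
    c≡ue : c ≡ u ++ e
    c≡ue = proj₁ (proj₂ split₁)
    X≡er : X ≡ e ++ r
    X≡er = proj₂ (proj₂ split₁)
    |c|≡ : length c ≡ length u + length e
    |c|≡ = trans (cong length c≡ue) (length-++ u)
    e≢[] : e ≢ []
    e≢[] e≡[] = <-irrefl (sym (trans |c|≡ (trans (cong (λ z → length u + length z) e≡[])
                                                  (+-identityʳ (length u))))) u<c
    e<X : length e < length X
    e<X = +-cancelˡ-< (length u) (length e) (length X)
            (subst₂ _<_ |c|≡ (length-++ u) c<w)
    w≡lue : u ++ X ≡ (l ++ u) ++ e
    w≡lue = trans w≡lc (trans (cong (l ++_) c≡ue) (sym (++-assoc l u e)))
    split₂ : Σ (List A) λ q → (l ++ u ≡ u ++ q) × (X ≡ q ++ e)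
    split₂ = ++-split u X (l ++ u) e w≡lue
               (subst (length u ≤_) (sym (length-++ l)) (m≤n+m (length u) (length l)))
    q : List A
    q = proj₁ split₂
    X≡qe : X ≡ q ++ e
    X≡qe = proj₂ (proj₂ split₂)

  -- A nonempty border e of X, X = q e = e r, gives P X X = P q e e r with r
  -- nonempty, so the square e e occurs in P X X before its last letter.
  border⇒square : (P X e : List A) → e ≢ [] → IsBoundary e X → HasSquare (dropLast (P ++ X ++ X))
  border⇒square P X e e≢[] (e<X , (r , X≡er) , (q , X≡qe)) with r | X≡er
  ... | [] | X≡e[] = ⊥-elim (<-irrefl (cong length (sym (trans X≡e[] (++-identityʳ e)))) e<X)
  ... | y ∷ r′ | X≡er′ =
    subst HasSquare (sym (trans (cong dropLast text≡) (dropLast-++ (P ++ q ++ e ++ e) y r′)))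
      (hasSquare-++ʳ (P ++ q ++ e ++ e) (take (length r′) (y ∷ r′))
        (P ++ q , e , [] , e≢[] , square≡))
    where
    open ≡-Reasoning
    square≡ : P ++ q ++ e ++ e ≡ (P ++ q) ++ e ++ e ++ []
    square≡ = begin
      P ++ q ++ e ++ e          ≡⟨ ++-assoc P q (e ++ e) ⟨
      (P ++ q) ++ e ++ e        ≡⟨ cong (λ v → (P ++ q) ++ e ++ v) (++-identityʳ e) ⟨
      (P ++ q) ++ e ++ e ++ []  ∎
    text≡ : P ++ X ++ X ≡ (P ++ q ++ e ++ e) ++ y ∷ r′
    text≡ = begin
      P ++ X ++ X                    ≡⟨ cong₂ (λ v w → P ++ v ++ w) X≡qe X≡er′ ⟩
      P ++ (q ++ e) ++ e ++ y ∷ r′   ≡⟨ cong (P ++_) (++-assoc q e (e ++ y ∷ r′)) ⟩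
      P ++ q ++ e ++ e ++ y ∷ r′     ≡⟨ cong (λ v → P ++ q ++ v) (++-assoc e e (y ∷ r′)) ⟨
      P ++ q ++ (e ++ e) ++ y ∷ r′   ≡⟨ cong (P ++_) (++-assoc q (e ++ e) (y ∷ r′)) ⟨
      P ++ (q ++ e ++ e) ++ y ∷ r′   ≡⟨ ++-assoc P (q ++ e ++ e) (y ∷ r′) ⟨
      (P ++ q ++ e ++ e) ++ y ∷ r′   ∎

  longest-border : (P x' x'' : List A) → x' ≢ [] →
                   Squarefree (dropLast (P ++ (x' ++ x'') ++ (x' ++ x''))) →
                   IsLongestBoundary x'' (x'' ++ x' ++ x'')
  longest-border P x' x'' x'≢[] sf =
    (x''<w , (x' ++ x'' , refl) , (x'' ++ x' , sym (++-assoc x'' x' x''))) , maximal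
    where
    x''<w : length x'' < length (x'' ++ x' ++ x'')
    x''<w = subst (length x'' <_) (sym (length-++ x''))
              (m<m+n (length x'') (subst (0 <_) (sym (length-++ x'))
                (≤-trans (nonempty⇒length>0 x'≢[]) (m≤m+n (length x') (length x'')))))
    maximal : ∀ c → IsBoundary c (x'' ++ x' ++ x'') → length c ≤ length x''
    maximal c c-border with length c ≤? length x''
    ... | yes c≤x'' = c≤x''
    ... | no c≰x'' with long-border⇒border x'' (x' ++ x'') c c-border (≰⇒> c≰x'')
    ...   | e , e≢[] , e-border = ⊥-elim (sf (border⇒square P (x' ++ x'') e e≢[] e-border))

  substr-suffix : (t Q w : List A) → t ≡ Q ++ w → substr t (suc (length Q)) (length t) ≡ w
  substr-suffix .(Q ++ w) Q w refl =
    trans (cong (take (length (Q ++ w) ∸ length Q)) (drop-length-++ Q w))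
          (take-all _ w (≤-reflexive (sym (length-++-∸ Q w))))

  suffix-split : (t s : List A) (a : ℕ) → s ≢ [] → substr t (suc a) (length t) ≡ s →
                 (t ≡ take a t ++ s) × (length (take a t) ≡ a)
  suffix-split t s a s≢[] factor = t≡ , trans (length-take a t) (m≤n⇒m⊓n≡m a≤t)
    where
    drop≡s : drop a t ≡ s
    drop≡s = trans (sym (take-all (length t ∸ a) (drop a t) (≤-reflexive (length-drop a t)))) factor
    t≡ : t ≡ take a t ++ s
    t≡ = trans (sym (take++drop≡id a t)) (cong (take a t ++_) drop≡s)
    a≤t : a ≤ length t
    a≤t with a ≤? length t
    ... | yes a≤t = a≤t
    ... | no a≰t = ⊥-elim (s≢[] (trans (sym drop≡s) (drop-all a t (<⇒≤ (≰⇒> a≰t)))))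

  -- The conclusion of lemma1 for text, n, j and the square root x = x' x'',
  -- where o is the length |x'| of the part cut off from x.
  ConclusionAt : List A → ℕ → ℕ → List A → ℕ → Set a
  ConclusionAt text n j x o =
    (length x ≤ n ∸ j) × (n ∸ j ∸ length x ≤ length x) ×
    (substr text (suc j) n ≡ drop o x ++ take o x ++ drop o x) ×
    IsLongestBoundary (drop o x) (substr text (suc j) n)

  Conclusion : List A → ℕ → ℕ → List A → Set a
  Conclusion text n j x = ConclusionAt text n j x (length x ∸ (n ∸ j ∸ length x))

  conclusion : (text P x' x'' x : List A) (j : ℕ) →
               x ≡ x' ++ x'' → text ≡ P ++ x ++ x → j ≡ length (P ++ x') → x' ≢ [] →
               Squarefree (dropLast text) → Conclusion text (length text) j x
  conclusion .(P ++ (x' ++ x'') ++ (x' ++ x'')) P x' x'' .(x' ++ x'') .(length (P ++ x'))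
             refl refl refl x'≢[] sf =
    subst (ConclusionAt text (length text) j X) (sym offset)
      (fits , overhang≤L , tail-shape , subst₂ IsLongestBoundary (sym drop≡x'') (sym tail) border)
    where
    X = x' ++ x''
    w = x'' ++ X
    L = length X
    u = length x'
    v = length x''
    text = P ++ X ++ X
    j = length (P ++ x')
    text≡ : text ≡ (P ++ x') ++ w
    text≡ = trans (cong (P ++_) (++-assoc x' x'' X)) (sym (++-assoc P x' w))
    tail : substr text (suc j) (length text) ≡ w
    tail = substr-suffix text (P ++ x') w text≡
    tail-length : length text ∸ j ≡ v + L
    tail-length = trans (cong (λ t → length t ∸ j) text≡)
                        (trans (length-++-∸ (P ++ x') w) (length-++ x''))
    overhang : length text ∸ j ∸ L ≡ v
    overhang = trans (cong (_∸ L) tail-length) (m+n∸n≡m v L)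
    offset : L ∸ (length text ∸ j ∸ L) ≡ u
    offset = trans (cong₂ _∸_ (length-++ x') overhang) (m+n∸n≡m u v)
    fits : L ≤ length text ∸ j
    fits = subst (L ≤_) (sym tail-length) (m≤n+m L v)
    overhang≤L : length text ∸ j ∸ L ≤ L
    overhang≤L = subst (_≤ L) (sym overhang) (subst (v ≤_) (sym (length-++ x')) (m≤n+m v u))
    drop≡x'' : drop u X ≡ x''
    drop≡x'' = drop-length-++ x' x''
    tail-shape : substr text (suc j) (length text) ≡ drop u X ++ take u X ++ drop u X
    tail-shape = trans tail (sym (cong₂ _++_ drop≡x'' (cong₂ _++_ (take-length-++ x' x'') drop≡x'')))
    border : IsLongestBoundary x'' w
    border = longest-border P x' x'' x'≢[] sf

lemma1 : ∀ {a : Level} {A : Set a} (text : List A) (n i j k : ℕ) (x : List A) →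
    length text ≡ n →
    Squarefree (substr text 1 (n ∸ 1)) →
    0 < i → i ≤ j → suc (j ∸ i) ≤ n ∸ j →
    i ≤ k → k ≤ j →
    IsSquareOf (substr text k n) x →
    (length x ≤ n ∸ j) × (n ∸ j ∸ length x ≤ length x) ×
    (substr text (suc j) n ≡ drop (length x ∸ (n ∸ j ∸ length x)) x ++ take (length x ∸ (n ∸ j ∸ length x)) x ++ drop (length x ∸ (n ∸ j ∸ length x)) x) ×
    IsLongestBoundary (drop (length x ∸ (n ∸ j ∸ length x)) x) (substr text (suc j) n)
lemma1 text n i j zero x _ _ 0<i _ _ i≤k _ _ = ⊥-elim (<⇒≱ 0<i i≤k)
lemma1 text .(length text) i j (suc a) x refl sf _ _ short i≤k k≤j (x≢[] , square)
  with m≤n⇒∃[o]m+o≡n k≤j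
... | m′ , refl = conclusion text P x' x'' x j (sym (take++drop≡id m x)) text≡ j≡ x'≢[] sf
  where
  -- k = a + 1 and j = a + m, so m = j - k + 1 ≥ 1 letters of x lie in text[k..j]
  m = suc m′
  L = length x
  P = take a text
  xx≢[] : x ++ x ≢ []
  xx≢[] xx≡[] = x≢[] (++-conicalˡ x x xx≡[])
  split : (text ≡ P ++ x ++ x) × (length P ≡ a)
  split = suffix-split text (x ++ x) a xx≢[] square
  text≡ : text ≡ P ++ x ++ x
  text≡ = proj₁ split
  |P|≡a : length P ≡ a
  |P|≡a = proj₂ split
  tail-length : length text ∸ j ≡ (L + L) ∸ m
  tail-length = trans (cong₂ _∸_ |text|≡ (sym (+-suc a m′))) ([m+n]∸[m+o]≡n∸o a (L + L) m)
    where
    |text|≡ : length text ≡ a + (L + L)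
    |text|≡ = trans (cong length text≡) (trans (length-++ P) (cong₂ _+_ |P|≡a (length-++ x)))
  -- m ≤ j - i + 1 ≤ n - j = 2L - m, hence m ≤ L
  m≤L : m ≤ L
  m≤L = ≤-half m L (subst (m ≤_) tail-length
          (≤-trans (s≤s (subst (_≤ j ∸ i) (m+n∸m≡n (suc a) m′) (∸-monoʳ-≤ j i≤k))) short))
  x' = take m x
  x'' = drop m x
  |x'|≡m : length x' ≡ m
  |x'|≡m = trans (length-take m x) (m≤n⇒m⊓n≡m m≤L)
  x'≢[] : x' ≢ []
  x'≢[] x'≡[] = 0≢1+n (trans (sym (cong length x'≡[])) |x'|≡m)
  j≡ : j ≡ length (P ++ x')
  j≡ = trans (sym (+-suc a m′)) (sym (trans (length-++ P) (cong₂ _+_ |P|≡a |x'|≡m)))
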